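{- Let $w \in W$ and $1 \le k < l < m \le n$. The following are equivalent: (1) $w \xrightarrow{(k, m)} ws_{(k, m)}$ is an edge of $\mathrm{QBG}(W)$, and $w \xrightarrow{(l, m)} ws_{(l, m)} \xrightarrow{(k, l)} ws_{(l, m)}s_{(k, l)}$ is a directed path in $\mathrm{QBG}(W)$; (2) $w \xrightarrow{(k, m)} ws_{(k, m)}$ and $w \xrightarrow{(l, m)} ws_{(l, m)}$ are edges of $\mathrm{QBG}(W)$; (3) $w \xrightarrow{(k, m)} ws_{(k, m)} \xrightarrow{(l, m)} ws_{(k, m)}s_{(l, m)}$ is a directed path in $\mathrm{QBG}(W)$.
   Context: $W$ is the Weyl group of type $C_n$ with length function $\ell$; positive roots $\Delta^+=\{\varepsilon_i-\varepsilon_j,\varepsilon_i+\varepsilon_j\ (1\le i<j\le n),\ 2\varepsilon_k\}$ in $\bigoplus\mathbb Z\varepsilon_k$, $\alpha^\vee$ the coroot, $\rho$ half the sum of positive roots, $s_\alpha$ the reflection in $\alpha$. For $1\le i<j\le n$, $(i,j):=\varepsilon_i-\varepsilon_j$ and $s_{(i,j)}$ its reflection. The quantum Bruhat graph $\mathrm{QBG}(W)$ has vertex set $W$ and an edge $x\xrightarrow{\alpha}xs_\alpha$ ($\alpha\in\Delta^+$) iff $\ell(xs_\alpha)=\ell(x)+1$ or $\ell(xs_\alpha)=\ell(x)-2\langle\rho,\alpha^\vee\rangle+1$. -}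

module Defs where

open import Data.Nat as ℕ using (ℕ; zero; suc)
open import Data.Integer as ℤ using (ℤ; +_; -_; _+_; _*_)
open import Data.Bool using (Bool; true; false; if_then_else_; _xor_)
open import Data.Fin using (Fin; _<_; _<?_; _≟_)
open import Data.Fin.Permutation as P using (Permutation′; _⟨$⟩ʳ_; _⟨$⟩ˡ_; _∘ₚ_; transpose)
open import Data.List as L using (List; []; _∷_; _++_; concatMap; allFin; filter)
open import Data.Product using (_×_; _,_)
open import Data.Sum using (_⊎_)
open import Relation.Binary.PropositionalEquality using (_≡_)
open import Relation.Nullary using (Dec; yes; no; does)
open import Relation.Nullary.Decidable.Core using (T?)

Vecℤ : ℕ → Set
Vecℤ n = Fin n → ℤ

ε : ∀ {n} → Fin n → Vecℤ n
ε i j = if does (i ≟ j) then + 1 else + 0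

_⊕_ : ∀ {n} → Vecℤ n → Vecℤ n → Vecℤ n
(u ⊕ v) i = u i + v i

_⊝_ : ∀ {n} → Vecℤ n → Vecℤ n → Vecℤ n
(u ⊝ v) i = u i + - v i

zeroV : ∀ {n} → Vecℤ n
zeroV _ = + 0

scale : ∀ {n} → ℤ → Vecℤ n → Vecℤ n
scale c v i = c * v i

dot : ∀ {n} → Vecℤ n → Vecℤ n → ℤ
dot {zero}  u v = + 0
dot {suc n} u v = u Data.Fin.zero * v Data.Fin.zero + dot {n} (λ i → u (Data.Fin.suc i)) (λ i → v (Data.Fin.suc i))

-- The Weyl group W of type C_n: signed permutations.
-- w ∈ W acts by  w(ε_i) = (-1)^{sgn w i} ε_{perm w i}.

record W (n : ℕ) : Set where
  constructor signedPerm
  field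
    perm : Permutation′ n
    sgn  : Fin n → Bool
open W public

act : ∀ {n} → W n → Vecℤ n → Vecℤ n
act w v j = let i = perm w ⟨$⟩ˡ j in
            if sgn w i then - v i else v i

-- group product (x y)(v) = x (y v)
_·_ : ∀ {n} → W n → W n → W n
x · y = signedPerm (perm y ∘ₚ perm x) (λ i → sgn y i xor sgn x (perm y ⟨$⟩ʳ i))

data PosRoot (n : ℕ) : Set where
  minus : (i j : Fin n) → i < j → PosRoot n
  plus  : (i j : Fin n) → i < j → PosRoot n
  long  : (k : Fin n) → PosRoot n

rootVec : ∀ {n} → PosRoot n → Vecℤ n
rootVec (minus i j _) = ε i ⊝ ε j
rootVec (plus  i j _) = ε i ⊕ ε j
rootVec (long k)      = ε k ⊕ ε k

-- coroot α^∨ = 2α/⟨α,α⟩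
corootVec : ∀ {n} → PosRoot n → Vecℤ n
corootVec (minus i j _) = ε i ⊝ ε j
corootVec (plus  i j _) = ε i ⊕ ε j
corootVec (long k)      = ε k

posRoots : (n : ℕ) → List (PosRoot n)
posRoots n =
  concatMap (λ i → concatMap (λ j → pairs i j (i <? j)) (allFin n)) (allFin n)
  L.++ L.map long (allFin n)
  where
  pairs : (i j : Fin n) → Dec (i < j) → List (PosRoot n)
  pairs i j (yes p) = minus i j p ∷ plus i j p ∷ []
  pairs i j (no _)  = []

twoRho : (n : ℕ) → Vecℤ n
twoRho n = L.foldr (λ α v → rootVec α ⊕ v) zeroV (posRoots n)

twoRhoPair : ∀ {n} → PosRoot n → ℤ
twoRhoPair {n} α = dot (twoRho n) (corootVec α)

-- a root is negative iff its first nonzero coordinate is negative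
isNegative : ∀ {n} → Vecℤ n → Bool
isNegative {zero}  v = false
isNegative {suc n} v with v Data.Fin.zero
... | ℤ.pos zero    = isNegative {n} (λ i → v (Data.Fin.suc i))
... | ℤ.pos (suc _) = false
... | ℤ.negsuc _    = true

len : ∀ {n} → W n → ℕ
len {n} w = L.length (filter (λ α → T? (isNegative (act w (rootVec α)))) (posRoots n))

flipAt : ∀ {n} → List (Fin n) → Fin n → Bool
flipAt []       i = false
flipAt (k ∷ ks) i = if does (k ≟ i) then true else flipAt ks i

refl-s : ∀ {n} → PosRoot n → W n
refl-s (minus i j _) = signedPerm (transpose i j) (λ _ → false)
refl-s (plus  i j _) = signedPerm (transpose i j) (flipAt (i ∷ j ∷ []))  -- ε_i ↦ -ε_j, ε_j ↦ -ε_i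
refl-s (long k)      = signedPerm P.id (flipAt (k ∷ []))

QBGEdge : ∀ {n} → W n → PosRoot n → Set
QBGEdge x α =
  (len (x · refl-s α) ≡ ℕ.suc (len x))
  ⊎ (+ len (x · refl-s α) ≡ (+ len x) + - twoRhoPair α + + 1)

[_,_]⟨_⟩ : ∀ {n} (i j : Fin n) → i < j → PosRoot n
[ i , j ]⟨ p ⟩ = minus i j p

s[_,_]⟨_⟩ : ∀ {n} (i j : Fin n) → i < j → W n
s[ i , j ]⟨ p ⟩ = refl-s (minus i j p)

module Submission where

-- Write w ε_i = ±ε_(π i) and let key w i be π i if the sign is + and 2n − 1 − π i otherwise.
-- Then w(ε_i − ε_j) < 0 iff key w j < key w i, so ℓ(w) is the number of inversions of key w
-- plus a count over the roots ε_i + ε_j and 2ε_k that is unchanged by w ↦ w s_(a,b), while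
-- key (w s_(a,b)) is key w with the values at a and b exchanged. Counting inversions,
-- ℓ(w s_(a,b)) − ℓ(w) = ±(1 + 2c), where c is the number of a < t < b whose key lies strictly
-- between key w a and key w b; and 2⟨ρ, (a,b)^∨⟩ = 2(b − a). Hence w → w s_(a,b) is an edge
-- iff either key w a < key w b and there is no such t (a Bruhat edge), or key w b < key w a
-- and every t strictly between a and b has its key strictly between key w b and key w a
-- (a quantum edge). For k < l < m the three conditions of the lemma thereby become statements
-- about the relative order of key values on the positions from k to m, checked case by case.

open import Defs
open import Data.Nat using (ℕ)
open import Data.Fin using (Fin; _<_)
open import Data.Fin.Properties using (<-trans)
open import Data.Product using (_×_)
open import Function.Bundles using (_⇔_)

open import Algebra.Bundles using (Monoid)
open import Data.Bool using (Bool; true; false; not; _∨_; if_then_else_)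
open import Data.Bool.Properties using (T-≡)
open import Data.Fin using (zero; suc; toℕ; _≟_; _<?_)
import Data.Fin.Properties as Finₚ
open import Data.Fin.Permutation using (_⟨$⟩ʳ_; _⟨$⟩ˡ_; inverseˡ; inverseʳ; transpose)
import Data.Fin.Permutation.Components as PC
open import Data.Integer as ℤ using (ℤ; +_; -_)
import Data.Integer.Properties as ℤₚ
open import Data.Integer.Tactic.RingSolver using () renaming (solve-∀ to ℤ-solve-∀)
open import Data.List using (List; []; _∷_; _++_; concat; concatMap; map; tabulate; allFin; filter; length; foldr)
open import Data.List.Properties using (map-cong)
open import Data.Nat as ℕ using (zero; suc; _+_; _*_; _∸_; _<ᵇ_; z≤n; s≤s)
import Data.Nat.Properties as ℕₚ
open import Data.Nat.Tactic.RingSolver using (solve-∀)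
open import Data.Product using (_,_; proj₁; proj₂)
open import Data.Sum using (_⊎_; inj₁; inj₂)
open import Data.Sum.Function.Propositional using (_⊎-⇔_)
open import Function.Base using (_∘_; id)
open import Function.Bundles using (Equivalence; mk⇔)
import Function.Construct.Composition as Compose
open import Relation.Binary.Definitions using (tri<; tri≈; tri>)
open import Relation.Binary.PropositionalEquality
open import Relation.Nullary using (¬_; Dec; does; yes; no; contradiction)
open import Relation.Nullary.Decidable using (dec-true; dec-false)
open import Relation.Nullary.Decidable.Core using (T?)

open import Algebra.Properties.Semiring.Sum ℕₚ.+-*-semiring
  using (sum-syntax; sum-cong-≗; ∑-distrib-+; ∑-permute; sum-replicate-zero; *-distribˡ-sum; *-distribʳ-sum)

⟦_⟧ : Bool → ℕ
⟦ true  ⟧ = 1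
⟦ false ⟧ = 0

<ᵇ-true : ∀ {m n} → m ℕ.< n → (m <ᵇ n) ≡ true
<ᵇ-true m<n = Equivalence.to T-≡ (ℕₚ.<⇒<ᵇ m<n)

<ᵇ≡true⇒< : ∀ {m n} → (m <ᵇ n) ≡ true → m ℕ.< n
<ᵇ≡true⇒< {m} {n} eq = ℕₚ.<ᵇ⇒< m n (Equivalence.from T-≡ eq)

<ᵇ-false : ∀ {m n} → ¬ m ℕ.< n → (m <ᵇ n) ≡ false
<ᵇ-false {m} {n} m≮n with m <ᵇ n in eq
... | false = refl
... | true  = contradiction (<ᵇ≡true⇒< eq) m≮n

<ᵇ-irrefl : ∀ m → (m <ᵇ m) ≡ false
<ᵇ-irrefl m = <ᵇ-false {m} {m} (ℕₚ.<-irrefl refl)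

<ᵇ-flip : ∀ {m n} → m ≢ n → (n <ᵇ m) ≡ not (m <ᵇ n)
<ᵇ-flip {m} {n} m≢n with ℕₚ.<-cmp m n
... | tri< m<n _ _ rewrite <ᵇ-true m<n | <ᵇ-false (ℕₚ.<⇒≯ m<n) = refl
... | tri≈ _ m≡n _ = contradiction m≡n m≢n
... | tri> _ _ m>n rewrite <ᵇ-true m>n | <ᵇ-false (ℕₚ.<⇒≯ m>n) = refl

⟦_<_<_⟧ : ℕ → ℕ → ℕ → ℕ
⟦ x < y < z ⟧ = ⟦ x <ᵇ y ⟧ * ⟦ y <ᵇ z ⟧

⟦<<⟧≡1⇔ : ∀ {x y z} → ⟦ x < y < z ⟧ ≡ 1 ⇔ (x ℕ.< y × y ℕ.< z)
⟦<<⟧≡1⇔ {x} {y} {z} = mk⇔ to from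
  where
  to : ⟦ x < y < z ⟧ ≡ 1 → x ℕ.< y × y ℕ.< z
  to eq with x <ᵇ y in x<y | y <ᵇ z in y<z
  ... | true  | true  = <ᵇ≡true⇒< x<y , <ᵇ≡true⇒< y<z
  ... | true  | false = contradiction eq λ ()
  ... | false | _     = contradiction eq λ ()
  from : x ℕ.< y × y ℕ.< z → ⟦ x < y < z ⟧ ≡ 1
  from (x<y , y<z) rewrite <ᵇ-true x<y | <ᵇ-true y<z = refl

⟦<<⟧≡0⇔ : ∀ {x y z} → ⟦ x < y < z ⟧ ≡ 0 ⇔ (¬ (x ℕ.< y × y ℕ.< z))
⟦<<⟧≡0⇔ {x} {y} {z} = mk⇔ to from
  where
  to : ⟦ x < y < z ⟧ ≡ 0 → ¬ (x ℕ.< y × y ℕ.< z)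
  to eq inside = contradiction (trans (sym (Equivalence.from ⟦<<⟧≡1⇔ inside)) eq) λ ()
  from : ¬ (x ℕ.< y × y ℕ.< z) → ⟦ x < y < z ⟧ ≡ 0
  from outside with x <ᵇ y in x<y | y <ᵇ z in y<z
  ... | true  | true  = contradiction (<ᵇ≡true⇒< x<y , <ᵇ≡true⇒< y<z) outside
  ... | true  | false = refl
  ... | false | _     = refl

⟦<<⟧≤1 : ∀ x y z → ⟦ x < y < z ⟧ ℕ.≤ 1
⟦<<⟧≤1 x y z with x <ᵇ y | y <ᵇ z
... | true  | true  = ℕₚ.≤-refl
... | true  | false = z≤n
... | false | _     = z≤n

exchange-identity : ∀ p q →
  ⟦ not q ⟧ + ⟦ not p ⟧ + 2 * (⟦ p ⟧ * ⟦ q ⟧) ≡ ⟦ p ⟧ + ⟦ q ⟧ + 2 * (⟦ not q ⟧ * ⟦ not p ⟧)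
exchange-identity true  true  = refl
exchange-identity true  false = refl
exchange-identity false true  = refl
exchange-identity false false = refl

δ : ∀ {n} → Fin n → Fin n → ℕ
δ a t = ⟦ does (t ≟ a) ⟧

∑-δ : ∀ {n} (a : Fin n) (f : Fin n → ℕ) → ∑[ t < n ] (δ a t * f t) ≡ f a
∑-δ {suc n} zero    f = trans (cong₂ _+_ (ℕₚ.+-identityʳ (f zero)) (sum-replicate-zero n)) (ℕₚ.+-identityʳ (f zero))
∑-δ {suc n} (suc a) f = ∑-δ a (f ∘ suc)

∑∑-δ : ∀ {n} (x : Fin n) (g : Fin n → Fin n → ℕ) → ∑[ i < n ] ∑[ j < n ] (g i j * δ x i) ≡ ∑[ j < n ] g x j
∑∑-δ {n} x g = begin
  ∑[ i < n ] ∑[ j < n ] (g i j * δ x i)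
    ≡⟨ sum-cong-≗ {n} (λ i → *-distribʳ-sum {n} (δ x i) (g i)) ⟨
  ∑[ i < n ] (∑[ j < n ] g i j * δ x i)
    ≡⟨ sum-cong-≗ (λ i → ℕₚ.*-comm (∑[ j < n ] g i j) (δ x i)) ⟩
  ∑[ i < n ] (δ x i * ∑[ j < n ] g i j)
    ≡⟨ ∑-δ x (λ i → ∑[ j < n ] g i j) ⟩
  ∑[ j < n ] g x j ∎
  where open ≡-Reasoning

outside : ∀ {n} → Fin n → Fin n → Fin n → ℕ
outside a b t = ⟦ not (does (t ≟ a) ∨ does (t ≟ b)) ⟧

outside-δ-partition : ∀ {n} {a b : Fin n} → a ≢ b → ∀ t → outside a b t + (δ a t + δ b t) ≡ 1
outside-δ-partition {a = a} {b} a≢b t with t ≟ a | t ≟ b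
... | yes refl | yes refl = contradiction refl a≢b
... | yes _    | no _     = refl
... | no _     | yes _    = refl
... | no _     | no _     = refl

∑-split : ∀ {n} {a b : Fin n} → a ≢ b → (f : Fin n → ℕ) →
          ∑[ t < n ] f t ≡ ∑[ t < n ] (outside a b t * f t) + f a + f b
∑-split {n} {a} {b} a≢b f = begin
  ∑[ t < n ] f t
    ≡⟨ sum-cong-≗ pointwise ⟩
  ∑[ t < n ] (outside a b t * f t + (δ a t * f t + δ b t * f t))
    ≡⟨ ∑-distrib-+ (λ t → outside a b t * f t) _ ⟩
  ∑[ t < n ] (outside a b t * f t) + ∑[ t < n ] (δ a t * f t + δ b t * f t)
    ≡⟨ cong (λ x → ∑[ t < n ] (outside a b t * f t) + x)
            (trans (∑-distrib-+ (λ t → δ a t * f t) _) (cong₂ _+_ (∑-δ a f) (∑-δ b f))) ⟩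
  ∑[ t < n ] (outside a b t * f t) + (f a + f b)
    ≡⟨ ℕₚ.+-assoc _ (f a) (f b) ⟨
  ∑[ t < n ] (outside a b t * f t) + f a + f b ∎
  where
  open ≡-Reasoning
  pointwise : ∀ t → f t ≡ outside a b t * f t + (δ a t * f t + δ b t * f t)
  pointwise t = begin
    f t
      ≡⟨ ℕₚ.*-identityˡ (f t) ⟨
    1 * f t
      ≡⟨ cong (_* f t) (outside-δ-partition a≢b t) ⟨
    (outside a b t + (δ a t + δ b t)) * f t
      ≡⟨ ℕₚ.*-distribʳ-+ (f t) (outside a b t) _ ⟩
    outside a b t * f t + (δ a t + δ b t) * f t
      ≡⟨ cong (λ x → outside a b t * f t + x) (ℕₚ.*-distribʳ-+ (f t) (δ a t) _) ⟩
    outside a b t * f t + (δ a t * f t + δ b t * f t) ∎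

∑-mono-≤ : ∀ {n} {f g : Fin n → ℕ} → (∀ i → f i ℕ.≤ g i) → ∑[ i < n ] f i ℕ.≤ ∑[ i < n ] g i
∑-mono-≤ {zero}  _   = z≤n
∑-mono-≤ {suc n} f≤g = ℕₚ.+-mono-≤ (f≤g zero) (∑-mono-≤ (f≤g ∘ suc))

+-≤-≡⇒≡ : ∀ {a b c d} → a ℕ.≤ b → c ℕ.≤ d → a + c ≡ b + d → a ≡ b × c ≡ d
+-≤-≡⇒≡ {a} {b} {c} {d} a≤b c≤d eq = a≡b , ℕₚ.+-cancelˡ-≡ a c d (trans eq (cong (_+ d) (sym a≡b)))
  where
  a≡b : a ≡ b
  a≡b = ℕₚ.≤-antisym a≤b (ℕₚ.+-cancelʳ-≤ d b a (subst (ℕ._≤ a + d) eq (ℕₚ.+-monoʳ-≤ a c≤d)))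

∑-≤-≡⇒≗ : ∀ {n} {f g : Fin n → ℕ} → (∀ i → f i ℕ.≤ g i) →
          ∑[ i < n ] f i ≡ ∑[ i < n ] g i → ∀ i → f i ≡ g i
∑-≤-≡⇒≗ {suc n} f≤g eq zero    = proj₁ (+-≤-≡⇒≡ (f≤g zero) (∑-mono-≤ (f≤g ∘ suc)) eq)
∑-≤-≡⇒≗ {suc n} f≤g eq (suc i) =
  ∑-≤-≡⇒≗ (f≤g ∘ suc) (proj₂ (+-≤-≡⇒≡ (f≤g zero) (∑-mono-≤ (f≤g ∘ suc)) eq)) i

∑∑-split : ∀ {n} {a b : Fin n} → a ≢ b → (G : Fin n → Fin n → ℕ) →
           ∑[ i < n ] ∑[ j < n ] G i j ≡
             ∑[ i < n ] (outside a b i * ∑[ j < n ] (outside a b j * G i j))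
             + ∑[ t < n ] (outside a b t * (G t a + G t b + G a t + G b t))
             + (G a a + G a b + G b a + G b b)
∑∑-split {n} {a} {b} a≢b G = begin
  ∑[ i < n ] ∑[ j < n ] G i j
    ≡⟨ sum-cong-≗ (λ i → ∑-split a≢b (G i)) ⟩
  ∑[ i < n ] (R i + G i a + G i b)
    ≡⟨ trans (∑-distrib-+ (λ i → R i + G i a) _) (cong (_+ ∑[ i < n ] G i b) (∑-distrib-+ R _)) ⟩
  ∑[ i < n ] R i + ∑[ i < n ] G i a + ∑[ i < n ] G i b
    ≡⟨ cong₂ _+_ (cong₂ _+_ (∑-split a≢b R) (∑-split a≢b (λ i → G i a))) (∑-split a≢b (λ i → G i b)) ⟩
  (out R + R a + R b) + (out (λ t → G t a) + G a a + G b a) + (out (λ t → G t b) + G a b + G b b)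
    ≡⟨ rearrange (out R) (R a) (R b) (out (λ t → G t a)) (out (λ t → G t b)) (G a a) (G a b) (G b a) (G b b) ⟩
  out R + (out (λ t → G t a) + out (λ t → G t b) + R a + R b) + (G a a + G a b + G b a + G b b)
    ≡⟨ cong (λ x → out R + x + (G a a + G a b + G b a + G b b)) boundary ⟨
  out R + out (λ t → G t a + G t b + G a t + G b t) + (G a a + G a b + G b a + G b b) ∎
  where
  open ≡-Reasoning
  out : (Fin n → ℕ) → ℕ
  out f = ∑[ t < n ] (outside a b t * f t)
  R : Fin n → ℕ
  R i = out (G i)
  out-+ : ∀ f g → out (λ t → f t + g t) ≡ out f + out g
  out-+ f g = trans (sum-cong-≗ (λ t → ℕₚ.*-distribˡ-+ (outside a b t) (f t) (g t)))
                    (∑-distrib-+ (λ t → outside a b t * f t) _)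
  boundary : out (λ t → G t a + G t b + G a t + G b t)
             ≡ out (λ t → G t a) + out (λ t → G t b) + R a + R b
  boundary = begin
    out (λ t → G t a + G t b + G a t + G b t)
      ≡⟨ out-+ (λ t → G t a + G t b + G a t) (G b) ⟩
    out (λ t → G t a + G t b + G a t) + R b
      ≡⟨ cong (_+ R b) (out-+ (λ t → G t a + G t b) (G a)) ⟩
    out (λ t → G t a + G t b) + R a + R b
      ≡⟨ cong (λ x → x + R a + R b) (out-+ (λ t → G t a) (λ t → G t b)) ⟩
    out (λ t → G t a) + out (λ t → G t b) + R a + R b ∎
  rearrange : ∀ r ra rb ca cb aa ab ba bb →
    (r + ra + rb) + (ca + aa + ba) + (cb + ab + bb) ≡ r + (ca + cb + ra + rb) + (aa + ab + ba + bb)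
  rearrange = solve-∀

outside-cong : ∀ {n} {a b : Fin n} t {x y : ℕ} → (t ≢ a → t ≢ b → x ≡ y) →
               outside a b t * x ≡ outside a b t * y
outside-cong {a = a} {b} t eq with t ≟ a | t ≟ b
... | yes _   | _      = refl
... | no _    | yes _  = refl
... | no t≢a  | no t≢b = cong (1 *_) (eq t≢a t≢b)

sumBetween : ∀ {n} → Fin n → Fin n → (Fin n → ℕ) → ℕ
sumBetween {n} a b g = ∑[ t < n ] (⟦ toℕ a < toℕ t < toℕ b ⟧ * g t)

sumBetween-cong : ∀ {n} {a b : Fin n} {g h : Fin n → ℕ} →
                  (∀ t → a < t → t < b → g t ≡ h t) → sumBetween a b g ≡ sumBetween a b h
sumBetween-cong {a = a} {b} {g} {h} eq = sum-cong-≗ pointwise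
  where
  pointwise : ∀ t → ⟦ toℕ a < toℕ t < toℕ b ⟧ * g t ≡ ⟦ toℕ a < toℕ t < toℕ b ⟧ * h t
  pointwise t with toℕ a <ᵇ toℕ t in a<t | toℕ t <ᵇ toℕ b in t<b
  ... | true  | true  = cong (_+ 0) (eq t (<ᵇ≡true⇒< a<t) (<ᵇ≡true⇒< t<b))
  ... | true  | false = refl
  ... | false | _     = refl

sumBetween-+ : ∀ {n} (a b : Fin n) (g h : Fin n → ℕ) →
               sumBetween a b (λ t → g t + h t) ≡ sumBetween a b g + sumBetween a b h
sumBetween-+ a b g h = trans (sum-cong-≗ λ t → ℕₚ.*-distribˡ-+ ⟦ toℕ a < toℕ t < toℕ b ⟧ (g t) (h t))
                             (∑-distrib-+ (λ t → ⟦ toℕ a < toℕ t < toℕ b ⟧ * g t) _)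

sumBetween-* : ∀ {n} (a b : Fin n) (k : ℕ) (g : Fin n → ℕ) →
               sumBetween a b (λ t → k * g t) ≡ k * sumBetween a b g
sumBetween-* a b k g = trans (sum-cong-≗ λ t → x*[k*y]≡k*[x*y] ⟦ toℕ a < toℕ t < toℕ b ⟧ k (g t))
                             (sym (*-distribˡ-sum k (λ t → ⟦ toℕ a < toℕ t < toℕ b ⟧ * g t)))
  where x*[k*y]≡k*[x*y] : ∀ x k y → x * (k * y) ≡ k * (x * y)
        x*[k*y]≡k*[x*y] = solve-∀

gap : ∀ {n} → Fin n → Fin n → ℕ
gap a b = sumBetween a b (λ _ → 1)

countInside : ∀ {n} → (Fin n → ℕ) → Fin n → Fin n → ℕ → ℕ → ℕ
countInside u a b x y = sumBetween a b (λ t → ⟦ x < u t < y ⟧)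

module _ {n : ℕ} {a b : Fin n} where

  private
    term-at : ∀ {t} (h : Fin n → ℕ) {m} → a < t → t < b →
              ⟦ toℕ a < toℕ t < toℕ b ⟧ * h t ≡ ⟦ toℕ a < toℕ t < toℕ b ⟧ * m → h t ≡ m
    term-at h {m} a<t t<b eq rewrite Equivalence.from ⟦<<⟧≡1⇔ (a<t , t<b) =
      trans (sym (ℕₚ.*-identityˡ (h _))) (trans eq (ℕₚ.*-identityˡ m))

  sumBetween≡0⇔ : (h : Fin n → ℕ) → sumBetween a b h ≡ 0 ⇔ (∀ t → a < t → t < b → h t ≡ 0)
  sumBetween≡0⇔ h = mk⇔ to from
    where
    to : sumBetween a b h ≡ 0 → ∀ t → a < t → t < b → h t ≡ 0
    to eq t a<t t<b = term-at h a<t t<b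
      (trans (sym (∑-≤-≡⇒≗ (λ _ → z≤n) (trans (sum-replicate-zero n) (sym eq)) t))
             (sym (ℕₚ.*-zeroʳ ⟦ toℕ a < toℕ t < toℕ b ⟧)))
    from : (∀ t → a < t → t < b → h t ≡ 0) → sumBetween a b h ≡ 0
    from h≡0 = trans (sumBetween-cong h≡0)
      (trans (sum-cong-≗ {n} {λ t → ⟦ toℕ a < toℕ t < toℕ b ⟧ * 0} {λ _ → 0}
                         (λ t → ℕₚ.*-zeroʳ ⟦ toℕ a < toℕ t < toℕ b ⟧))
             (sum-replicate-zero n))

  sumBetween≡count⇔ : (h : Fin n → ℕ) → (∀ t → h t ℕ.≤ 1) →
    sumBetween a b h ≡ sumBetween a b (λ _ → 1) ⇔ (∀ t → a < t → t < b → h t ≡ 1)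
  sumBetween≡count⇔ h h≤1 = mk⇔ to sumBetween-cong
    where
    to : sumBetween a b h ≡ sumBetween a b (λ _ → 1) → ∀ t → a < t → t < b → h t ≡ 1
    to eq t a<t t<b = term-at h a<t t<b
      (∑-≤-≡⇒≗ (λ t → ℕₚ.*-monoʳ-≤ ⟦ toℕ a < toℕ t < toℕ b ⟧ (h≤1 t)) eq t)

module _ {n : ℕ} (u : Fin n → ℕ) (a b : Fin n) where

  countInside≡0⇔ : ∀ {x y} →
    countInside u a b x y ≡ 0 ⇔ (∀ t → a < t → t < b → ¬ (x ℕ.< u t × u t ℕ.< y))
  countInside≡0⇔ {x} {y} = mk⇔
    (λ eq t a<t t<b → Equivalence.to ⟦<<⟧≡0⇔ (Equivalence.to (sumBetween≡0⇔ _) eq t a<t t<b))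
    (λ none → Equivalence.from (sumBetween≡0⇔ _) λ t a<t t<b → Equivalence.from ⟦<<⟧≡0⇔ (none t a<t t<b))

  countInside≡gap⇔ : ∀ {x y} →
    countInside u a b x y ≡ gap a b ⇔ (∀ t → a < t → t < b → x ℕ.< u t × u t ℕ.< y)
  countInside≡gap⇔ {x} {y} = mk⇔
    (λ eq t a<t t<b → Equivalence.to ⟦<<⟧≡1⇔ (Equivalence.to (sumBetween≡count⇔ _ bounded) eq t a<t t<b))
    (λ all → Equivalence.from (sumBetween≡count⇔ _ bounded)
                 λ t a<t t<b → Equivalence.from ⟦<<⟧≡1⇔ (all t a<t t<b))
    where
    bounded : ∀ t → ⟦ x < u t < y ⟧ ℕ.≤ 1
    bounded t = ⟦<<⟧≤1 x (u t) y

  countInside-reversed : ∀ {x y} → y ℕ.< x → countInside u a b x y ≡ 0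
  countInside-reversed y<x =
    Equivalence.from countInside≡0⇔ λ _ _ _ (x<z , z<y) → ℕₚ.<-asym y<x (ℕₚ.<-trans x<z z<y)

-- Pair sums, inversions and transpositions

pairSum : ∀ {n} → (Fin n → Fin n → ℕ) → ℕ
pairSum {n} f = ∑[ i < n ] ∑[ j < n ] (⟦ toℕ i <ᵇ toℕ j ⟧ * f i j)

pairSum-+ : ∀ {n} (f g : Fin n → Fin n → ℕ) → pairSum (λ i j → f i j + g i j) ≡ pairSum f + pairSum g
pairSum-+ {n} f g = trans
  (sum-cong-≗ λ i → trans (sum-cong-≗ λ j → ℕₚ.*-distribˡ-+ ⟦ toℕ i <ᵇ toℕ j ⟧ (f i j) (g i j))
                          (∑-distrib-+ (λ j → ⟦ toℕ i <ᵇ toℕ j ⟧ * f i j) _))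
  (∑-distrib-+ (λ i → ∑[ j < n ] (⟦ toℕ i <ᵇ toℕ j ⟧ * f i j)) _)

inversions : ∀ {n} → (Fin n → ℕ) → ℕ
inversions u = pairSum (λ i j → ⟦ u j <ᵇ u i ⟧)

sumBetween-exchange : ∀ {n} {a b : Fin n} (u : Fin n → ℕ) → (∀ {i j} → u i ≡ u j → i ≡ j) →
  sumBetween a b (λ t → ⟦ u b <ᵇ u t ⟧ + ⟦ u t <ᵇ u a ⟧) + 2 * countInside u a b (u a) (u b)
  ≡ sumBetween a b (λ t → ⟦ u a <ᵇ u t ⟧ + ⟦ u t <ᵇ u b ⟧) + 2 * countInside u a b (u b) (u a)
sumBetween-exchange {a = a} {b} u u-injective = begin
  sumBetween a b (λ t → ⟦ u b <ᵇ u t ⟧ + ⟦ u t <ᵇ u a ⟧) + 2 * countInside u a b (u a) (u b)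
    ≡⟨ cong (λ x → sumBetween a b (λ t → ⟦ u b <ᵇ u t ⟧ + ⟦ u t <ᵇ u a ⟧) + x) (sumBetween-* a b 2 _) ⟨
  sumBetween a b (λ t → ⟦ u b <ᵇ u t ⟧ + ⟦ u t <ᵇ u a ⟧) + sumBetween a b (λ t → 2 * ⟦ u a < u t < u b ⟧)
    ≡⟨ sumBetween-+ a b _ _ ⟨
  sumBetween a b (λ t → ⟦ u b <ᵇ u t ⟧ + ⟦ u t <ᵇ u a ⟧ + 2 * ⟦ u a < u t < u b ⟧)
    ≡⟨ sumBetween-cong exchange-at ⟩
  sumBetween a b (λ t → ⟦ u a <ᵇ u t ⟧ + ⟦ u t <ᵇ u b ⟧ + 2 * ⟦ u b < u t < u a ⟧)
    ≡⟨ sumBetween-+ a b _ _ ⟩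
  sumBetween a b (λ t → ⟦ u a <ᵇ u t ⟧ + ⟦ u t <ᵇ u b ⟧) + sumBetween a b (λ t → 2 * ⟦ u b < u t < u a ⟧)
    ≡⟨ cong (λ x → sumBetween a b (λ t → ⟦ u a <ᵇ u t ⟧ + ⟦ u t <ᵇ u b ⟧) + x) (sumBetween-* a b 2 _) ⟩
  sumBetween a b (λ t → ⟦ u a <ᵇ u t ⟧ + ⟦ u t <ᵇ u b ⟧) + 2 * countInside u a b (u b) (u a) ∎
  where
  open ≡-Reasoning
  exchange-at : ∀ t → a < t → t < b →
    ⟦ u b <ᵇ u t ⟧ + ⟦ u t <ᵇ u a ⟧ + 2 * ⟦ u a < u t < u b ⟧
    ≡ ⟦ u a <ᵇ u t ⟧ + ⟦ u t <ᵇ u b ⟧ + 2 * ⟦ u b < u t < u a ⟧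
  exchange-at t a<t t<b
    rewrite <ᵇ-flip {u t} {u b} (Finₚ.<⇒≢ t<b ∘ u-injective)
          | <ᵇ-flip {u a} {u t} (Finₚ.<⇒≢ a<t ∘ u-injective)
    = exchange-identity (u a <ᵇ u t) (u t <ᵇ u b)

module Transposition {n : ℕ} {a b : Fin n} (a<b : a < b) where

  τ : Fin n → Fin n
  τ = PC.transpose a b

  a≢b : a ≢ b
  a≢b = Finₚ.<⇒≢ a<b

  τ-a : τ a ≡ b
  τ-a rewrite dec-true (a ≟ a) refl = refl

  τ-b : τ b ≡ a
  τ-b rewrite dec-false (b ≟ a) (a≢b ∘ sym) | dec-true (b ≟ b) refl = refl

  τ-fix : ∀ {t} → t ≢ a → t ≢ b → τ t ≡ t
  τ-fix {t} t≢a t≢b rewrite dec-false (t ≟ a) t≢a | dec-false (t ≟ b) t≢b = refl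

  private
    classify : ∀ t → t ≡ a ⊎ t ≡ b ⊎ (t ≢ a × t ≢ b)
    classify t with t ≟ a | t ≟ b
    ... | yes t≡a | _       = inj₁ t≡a
    ... | no _    | yes t≡b = inj₂ (inj₁ t≡b)
    ... | no t≢a  | no t≢b  = inj₂ (inj₂ (t≢a , t≢b))

    outside-a : outside a b a ≡ 0
    outside-a rewrite dec-true (a ≟ a) refl = refl

    outside-b : outside a b b ≡ 0
    outside-b rewrite dec-false (b ≟ a) (a≢b ∘ sym) | dec-true (b ≟ b) refl = refl

    outside-other : ∀ {t} → t ≢ a → t ≢ b → outside a b t ≡ 1
    outside-other {t} t≢a t≢b rewrite dec-false (t ≟ a) t≢a | dec-false (t ≟ b) t≢b = refl

    -- p and q stand for t < a and t < b at a position t ∉ {a, b}; p implies q since a < b.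
    boundary-identity : ∀ p q → (p ≡ true → q ≡ true) → ∀ ta tb at bt →
      1 * (⟦ p ⟧ * tb + ⟦ q ⟧ * ta + ⟦ not p ⟧ * bt + ⟦ not q ⟧ * at) + ⟦ not p ⟧ * ⟦ q ⟧ * (tb + at)
      ≡ 1 * (⟦ p ⟧ * ta + ⟦ q ⟧ * tb + ⟦ not p ⟧ * at + ⟦ not q ⟧ * bt) + ⟦ not p ⟧ * ⟦ q ⟧ * (ta + bt)
    boundary-identity true  true  _   = solve-∀
    boundary-identity true  false p⇒q = contradiction (p⇒q refl) λ ()
    boundary-identity false true  _   = solve-∀
    boundary-identity false false _   = solve-∀

  module _ (f : Fin n → Fin n → ℕ) where

    private
      G H : Fin n → Fin n → ℕ
      G i j = ⟦ toℕ i <ᵇ toℕ j ⟧ * f (τ i) (τ j)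
      H i j = ⟦ toℕ i <ᵇ toℕ j ⟧ * f i j

      boundary-τ : ∀ t →
        outside a b t * (G t a + G t b + G a t + G b t) + ⟦ toℕ a < toℕ t < toℕ b ⟧ * (f t b + f a t)
        ≡ outside a b t * (H t a + H t b + H a t + H b t) + ⟦ toℕ a < toℕ t < toℕ b ⟧ * (f t a + f b t)
      boundary-τ t with classify t
      ... | inj₁ refl rewrite outside-a | <ᵇ-irrefl (toℕ a) = refl
      ... | inj₂ (inj₁ refl) rewrite outside-b | <ᵇ-true a<b | <ᵇ-irrefl (toℕ b) = refl
      ... | inj₂ (inj₂ (t≢a , t≢b))
        rewrite outside-other t≢a t≢b | τ-a | τ-b | τ-fix t≢a t≢b
              | <ᵇ-flip (t≢a ∘ Finₚ.toℕ-injective) | <ᵇ-flip (t≢b ∘ Finₚ.toℕ-injective)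
        = boundary-identity (toℕ t <ᵇ toℕ a) (toℕ t <ᵇ toℕ b)
            (λ t<a → <ᵇ-true (ℕₚ.<-trans (<ᵇ≡true⇒< t<a) a<b)) (f t a) (f t b) (f a t) (f b t)

      corners-τ : G a a + G a b + G b a + G b b + f a b ≡ H a a + H a b + H b a + H b b + f b a
      corners-τ rewrite τ-a | τ-b | <ᵇ-irrefl (toℕ a) | <ᵇ-irrefl (toℕ b)
                      | <ᵇ-true a<b | <ᵇ-false (ℕₚ.<⇒≯ a<b) = swap (f b a) (f a b)
        where swap : ∀ x y → 0 + 1 * x + 0 + 0 + y ≡ 0 + 1 * y + 0 + 0 + x
              swap = solve-∀

    -- Under τ only the pairs (a, b), (a, t) and (t, b) with a < t < b change their relative
    -- order; they account for the correction terms.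
    pairSum-transpose :
      pairSum (λ i j → f (τ i) (τ j)) + sumBetween a b (λ t → f t b + f a t) + f a b
      ≡ pairSum f + sumBetween a b (λ t → f t a + f b t) + f b a
    pairSum-transpose = begin
      pairSum (λ i j → f (τ i) (τ j)) + sumBetween a b (λ t → f t b + f a t) + f a b
        ≡⟨ cong (λ x → x + sumBetween a b (λ t → f t b + f a t) + f a b) (∑∑-split a≢b G) ⟩
      (inner G + edges G + corners G) + sumBetween a b (λ t → f t b + f a t) + f a b
        ≡⟨ regroup (inner G) (edges G) (corners G) _ (f a b) ⟩
      inner G + (edges G + sumBetween a b (λ t → f t b + f a t)) + (corners G + f a b)
        ≡⟨ cong₂ _+_ (cong₂ _+_ inner-τ edges-τ) corners-τ ⟩
      inner H + (edges H + sumBetween a b (λ t → f t a + f b t)) + (corners H + f b a)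
        ≡⟨ regroup (inner H) (edges H) (corners H) _ (f b a) ⟨
      (inner H + edges H + corners H) + sumBetween a b (λ t → f t a + f b t) + f b a
        ≡⟨ cong (λ x → x + sumBetween a b (λ t → f t a + f b t) + f b a) (∑∑-split a≢b H) ⟨
      pairSum f + sumBetween a b (λ t → f t a + f b t) + f b a ∎
      where
      open ≡-Reasoning
      inner edges corners : (Fin n → Fin n → ℕ) → ℕ
      inner   K = ∑[ i < n ] (outside a b i * ∑[ j < n ] (outside a b j * K i j))
      edges   K = ∑[ t < n ] (outside a b t * (K t a + K t b + K a t + K b t))
      corners K = K a a + K a b + K b a + K b b
      regroup : ∀ i e c s x → i + e + c + s + x ≡ i + (e + s) + (c + x)
      regroup = solve-∀
      inner-τ : inner G ≡ inner H
      inner-τ = sum-cong-≗ λ i → outside-cong i λ i≢a i≢b → sum-cong-≗ λ j → outside-cong j λ j≢a j≢b →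
        cong₂ (λ x y → ⟦ toℕ i <ᵇ toℕ j ⟧ * f x y) (τ-fix i≢a i≢b) (τ-fix j≢a j≢b)
      edges-τ : edges G + sumBetween a b (λ t → f t b + f a t) ≡ edges H + sumBetween a b (λ t → f t a + f b t)
      edges-τ = begin
        edges G + sumBetween a b (λ t → f t b + f a t)
          ≡⟨ ∑-distrib-+ (λ t → outside a b t * (G t a + G t b + G a t + G b t)) _ ⟨
        ∑[ t < n ] (outside a b t * (G t a + G t b + G a t + G b t) + ⟦ toℕ a < toℕ t < toℕ b ⟧ * (f t b + f a t))
          ≡⟨ sum-cong-≗ boundary-τ ⟩
        ∑[ t < n ] (outside a b t * (H t a + H t b + H a t + H b t) + ⟦ toℕ a < toℕ t < toℕ b ⟧ * (f t a + f b t))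
          ≡⟨ ∑-distrib-+ (λ t → outside a b t * (H t a + H t b + H a t + H b t)) _ ⟩
        edges H + sumBetween a b (λ t → f t a + f b t) ∎

  pairSum-transpose-symmetric : (f : Fin n → Fin n → ℕ) → (∀ i j → i ≢ j → f i j ≡ f j i) →
                                pairSum (λ i j → f (τ i) (τ j)) ≡ pairSum f
  pairSum-transpose-symmetric f f-sym = ℕₚ.+-cancelʳ-≡ (S + f a b) _ _ (begin
    pairSum (λ i j → f (τ i) (τ j)) + (S + f a b)
      ≡⟨ ℕₚ.+-assoc (pairSum (λ i j → f (τ i) (τ j))) S (f a b) ⟨
    pairSum (λ i j → f (τ i) (τ j)) + S + f a b
      ≡⟨ pairSum-transpose f ⟩
    pairSum f + sumBetween a b (λ t → f t a + f b t) + f b a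
      ≡⟨ cong₂ (λ x y → pairSum f + x + y) (sumBetween-cong between-sym) (f-sym b a (a≢b ∘ sym)) ⟩
    pairSum f + S + f a b
      ≡⟨ ℕₚ.+-assoc (pairSum f) S (f a b) ⟩
    pairSum f + (S + f a b) ∎)
    where
    open ≡-Reasoning
    S : ℕ
    S = sumBetween a b (λ t → f t b + f a t)
    between-sym : ∀ t → a < t → t < b → f t a + f b t ≡ f t b + f a t
    between-sym t a<t t<b = trans (cong₂ _+_ (f-sym t a (Finₚ.<⇒≢ a<t ∘ sym)) (f-sym b t (Finₚ.<⇒≢ t<b ∘ sym)))
                                  (ℕₚ.+-comm (f a t) (f t b))

  inversions-transpose : (u : Fin n → ℕ) → (∀ {i j} → u i ≡ u j → i ≡ j) →
    inversions (u ∘ τ) + ⟦ u b <ᵇ u a ⟧ + 2 * countInside u a b (u b) (u a)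
    ≡ inversions u + ⟦ u a <ᵇ u b ⟧ + 2 * countInside u a b (u a) (u b)
  inversions-transpose u u-injective = ℕₚ.+-cancelʳ-≡ (S₁ + 2 * C) _ _ (begin
    inversions (u ∘ τ) + ⟦ u b <ᵇ u a ⟧ + 2 * C′ + (S₁ + 2 * C)
      ≡⟨ shuffle (inversions (u ∘ τ)) _ (2 * C′) S₁ (2 * C) ⟩
    (inversions (u ∘ τ) + S₁ + ⟦ u b <ᵇ u a ⟧) + (2 * C + 2 * C′)
      ≡⟨ cong₂ _+_ (pairSum-transpose (λ i j → ⟦ u j <ᵇ u i ⟧)) (ℕₚ.+-comm (2 * C) (2 * C′)) ⟩
    (inversions u + S₂ + ⟦ u a <ᵇ u b ⟧) + (2 * C′ + 2 * C)
      ≡⟨ shuffle (inversions u) _ (2 * C) S₂ (2 * C′) ⟨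
    inversions u + ⟦ u a <ᵇ u b ⟧ + 2 * C + (S₂ + 2 * C′)
      ≡⟨ cong (λ x → inversions u + ⟦ u a <ᵇ u b ⟧ + 2 * C + x) (sumBetween-exchange u u-injective) ⟨
    inversions u + ⟦ u a <ᵇ u b ⟧ + 2 * C + (S₁ + 2 * C) ∎)
    where
    open ≡-Reasoning
    S₁ S₂ C C′ : ℕ
    S₁ = sumBetween a b (λ t → ⟦ u b <ᵇ u t ⟧ + ⟦ u t <ᵇ u a ⟧)
    S₂ = sumBetween a b (λ t → ⟦ u a <ᵇ u t ⟧ + ⟦ u t <ᵇ u b ⟧)
    C  = countInside u a b (u a) (u b)
    C′ = countInside u a b (u b) (u a)
    shuffle : ∀ i x c s d → i + x + c + (s + d) ≡ (i + s + x) + (d + c)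
    shuffle = solve-∀

rootPairs : ∀ {n} (i j : Fin n) → Dec (i < j) → List (PosRoot n)
rootPairs i j (yes i<j) = minus i j i<j ∷ plus i j i<j ∷ []
rootPairs i j (no _)    = []

mutual
  posRoots-≡ : ∀ n → posRoots n ≡
    concatMap (λ i → concatMap (λ j → rootPairs i j (i <? j)) (allFin n)) (allFin n) ++ map long (allFin n)
  posRoots-≡ n = cong (_++ map long (allFin n))
    (cong concat (map-cong (λ i → cong concat (map-cong (pairs-≡ n i) (allFin n))) (allFin n)))

  -- The left-hand side is the helper pairs local to posRoots in Defs, which cannot be named here;
  -- it is left to unification with the use above.
  pairs-≡ : ∀ n (i j : Fin n) → _ ≡ rootPairs i j (i <? j)
  pairs-≡ n i j with i <? j
  ... | yes _ = refl
  ... | no _  = refl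

module FoldMap {c ℓ} (M : Monoid c ℓ) where

  open Monoid M using (Carrier; _≈_; _∙_; ∙-cong; ∙-congˡ; assoc; identityˡ; reflexive)
    renaming (ε to 0ᴹ; refl to ≈-refl; sym to ≈-sym; trans to ≈-trans)
  open import Algebra.Properties.Monoid.Sum M using () renaming (sum to ∑ᴹ; sum-cong-≋ to ∑ᴹ-cong)

  foldMap : {A : Set} → (A → Carrier) → List A → Carrier
  foldMap g = foldr (λ x s → g x ∙ s) 0ᴹ

  foldMap-++ : ∀ {A : Set} (g : A → Carrier) xs ys → foldMap g (xs ++ ys) ≈ foldMap g xs ∙ foldMap g ys
  foldMap-++ g []       ys = ≈-sym (identityˡ _)
  foldMap-++ g (x ∷ xs) ys = ≈-trans (∙-congˡ (foldMap-++ g xs ys)) (≈-sym (assoc (g x) _ _))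

  foldMap-concatMap : ∀ {A B : Set} {m} (g : A → Carrier) (h : B → List A) (f : Fin m → B) →
                      foldMap g (concatMap h (tabulate f)) ≈ ∑ᴹ (λ i → foldMap g (h (f i)))
  foldMap-concatMap {m = zero}  g h f = ≈-refl
  foldMap-concatMap {m = suc m} g h f =
    ≈-trans (foldMap-++ g (h (f zero)) _) (∙-congˡ (foldMap-concatMap g h (f ∘ suc)))

  foldMap-map : ∀ {A B : Set} {m} (g : A → Carrier) (h : B → A) (f : Fin m → B) →
                foldMap g (map h (tabulate f)) ≈ ∑ᴹ (λ i → g (h (f i)))
  foldMap-map {m = zero}  g h f = ≈-refl
  foldMap-map {m = suc m} g h f = ∙-congˡ (foldMap-map g h (f ∘ suc))

  foldMap-posRoots : ∀ n (g : PosRoot n → Carrier) →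
    foldMap g (posRoots n) ≈ ∑ᴹ (λ i → ∑ᴹ (λ j → foldMap g (rootPairs i j (i <? j)))) ∙ ∑ᴹ (λ k → g (long k))
  foldMap-posRoots n g = ≈-trans (reflexive (cong (foldMap g) (posRoots-≡ n)))
    (≈-trans (foldMap-++ g (concatMap (λ i → concatMap (λ j → rootPairs i j (i <? j)) (allFin n)) (allFin n)) _)
           (∙-cong (≈-trans (foldMap-concatMap g (λ i → concatMap (λ j → rootPairs i j (i <? j)) (allFin n)) id)
                          (∑ᴹ-cong λ i → foldMap-concatMap g (λ j → rootPairs i j (i <? j)) id))
                   (foldMap-map g long id)))

-- The sign of w α and the key of w

position : ∀ {n} → W n → Fin n → ℕ
position w x = toℕ (perm w ⟨$⟩ʳ x)

position-injective : ∀ {n} (w : W n) {x y} → position w x ≡ position w y → x ≡ y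
position-injective w {x} {y} eq = begin
  x                                  ≡⟨ inverseˡ (perm w) ⟨
  perm w ⟨$⟩ˡ (perm w ⟨$⟩ʳ x)         ≡⟨ cong (perm w ⟨$⟩ˡ_) (Finₚ.toℕ-injective eq) ⟩
  perm w ⟨$⟩ˡ (perm w ⟨$⟩ʳ y)         ≡⟨ inverseˡ (perm w) ⟩
  y                                  ∎
  where open ≡-Reasoning

signBit : ℤ → Bool
signBit (ℤ.pos _)    = false
signBit (ℤ.negsuc _) = true

flipSign : Bool → ℤ → ℤ
flipSign s z = if s then - z else z

flipSign-0 : ∀ s → flipSign s (+ 0) ≡ + 0
flipSign-0 true  = refl
flipSign-0 false = refl

flipSign-≢0 : ∀ s {z} → z ≢ + 0 → flipSign s z ≢ + 0
flipSign-≢0 false z≢0 = z≢0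
flipSign-≢0 true {ℤ.pos zero} z≢0 = contradiction refl z≢0
flipSign-≢0 true {ℤ.pos (suc _)} _ ()
flipSign-≢0 true {ℤ.negsuc _} _ ()

isNegative-leading : ∀ {n} (v : Vecℤ n) (q : Fin n) →
                     (∀ j → j < q → v j ≡ + 0) → v q ≢ + 0 → isNegative v ≡ signBit (v q)
isNegative-leading {suc n} v zero _ v0≢0 with v zero
... | ℤ.pos zero    = contradiction refl v0≢0
... | ℤ.pos (suc _) = refl
... | ℤ.negsuc _    = refl
isNegative-leading {suc n} v (suc q) before vq≢0 with v zero | before zero (s≤s z≤n)
... | .(+ 0) | refl = isNegative-leading (v ∘ suc) q (λ j j<q → before (suc j) (s≤s j<q)) vq≢0

isNegative-act : ∀ {n} (w : W n) (v : Vecℤ n) (x : Fin n) →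
                 (∀ i → position w i ℕ.< position w x → v i ≡ + 0) → v x ≢ + 0 →
                 isNegative (act w v) ≡ signBit (flipSign (sgn w x) (v x))
isNegative-act w v x before vx≢0 =
  trans (isNegative-leading (act w v) (perm w ⟨$⟩ʳ x) earlier
                            (flipSign-≢0 (sgn w x) vx≢0 ∘ trans (sym act-x)))
        (cong signBit act-x)
  where
  act-x : act w v (perm w ⟨$⟩ʳ x) ≡ flipSign (sgn w x) (v x)
  act-x = cong (λ i → flipSign (sgn w i) (v i)) (inverseˡ (perm w))
  earlier : ∀ j → j < perm w ⟨$⟩ʳ x → act w v j ≡ + 0
  earlier j j<x = trans (cong (flipSign _) (before (perm w ⟨$⟩ˡ j)
                          (subst (ℕ._< position w x) (sym (cong toℕ (inverseʳ (perm w)))) j<x)))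
                        (flipSign-0 _)

isNegative-act₂ : ∀ {n} (w : W n) (v : Vecℤ n) (x y : Fin n) →
                  (∀ i → i ≢ x → i ≢ y → v i ≡ + 0) → v x ≢ + 0 → position w x ℕ.< position w y →
                  isNegative (act w v) ≡ signBit (flipSign (sgn w x) (v x))
isNegative-act₂ w v x y support vx≢0 x<y = isNegative-act w v x earlier vx≢0
  where
  earlier : ∀ i → position w i ℕ.< position w x → v i ≡ + 0
  earlier i i<x = support i (λ { refl → ℕₚ.<-irrefl refl i<x }) (λ { refl → ℕₚ.<-asym i<x x<y })

-- For p < n, n + (n ∸ suc p) = 2n − 1 − p: negative entries get the larger keys, in reverse order.
keyOf : ℕ → Bool → ℕ → ℕ
keyOf n false p = p
keyOf n true  p = n + (n ∸ suc p)

keyOf-order : ∀ {n p q} s t → p ℕ.< q → q ℕ.< n → (keyOf n t q <ᵇ keyOf n s p) ≡ s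
keyOf-order     false false p<q _   = <ᵇ-false (ℕₚ.<⇒≯ p<q)
keyOf-order {n} true  false _   q<n = <ᵇ-true (ℕₚ.<-≤-trans q<n (ℕₚ.m≤m+n n _))
keyOf-order {n} false true  p<q q<n =
  <ᵇ-false (ℕₚ.≤⇒≯ (ℕₚ.≤-trans (ℕₚ.<⇒≤ (ℕₚ.<-trans p<q q<n)) (ℕₚ.m≤m+n n _)))
keyOf-order {n} true  true  p<q q<n = <ᵇ-true (ℕₚ.+-monoʳ-< n (ℕₚ.∸-monoʳ-< (s≤s p<q) q<n))

keyOf-injective : ∀ {n p q} s t → p ℕ.< n → q ℕ.< n → keyOf n s p ≡ keyOf n t q → p ≡ q
keyOf-injective false false _   _   eq = eq
keyOf-injective {n} true true p<n q<n eq =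
  ℕₚ.suc-injective (ℕₚ.∸-cancelˡ-≡ p<n q<n (ℕₚ.+-cancelˡ-≡ n _ _ eq))
keyOf-injective {n} false true p<n _ eq = contradiction eq (ℕₚ.<⇒≢ (ℕₚ.<-≤-trans p<n (ℕₚ.m≤m+n n _)))
keyOf-injective {n} true false _ q<n eq = contradiction (sym eq) (ℕₚ.<⇒≢ (ℕₚ.<-≤-trans q<n (ℕₚ.m≤m+n n _)))

key : ∀ {n} → W n → Fin n → ℕ
key {n} w x = keyOf n (sgn w x) (position w x)

key-injective : ∀ {n} (w : W n) {x y} → key w x ≡ key w y → x ≡ y
key-injective w {x} {y} eq = position-injective w
  (keyOf-injective (sgn w x) (sgn w y) (Finₚ.toℕ<n _) (Finₚ.toℕ<n _) eq)

key-order : ∀ {n} (w : W n) {x y} → position w x ℕ.< position w y → (key w y <ᵇ key w x) ≡ sgn w x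
key-order w {x} {y} x<y = keyOf-order (sgn w x) (sgn w y) x<y (Finₚ.toℕ<n _)

signBit-flipSign-pos : ∀ s m → signBit (flipSign s (+ suc m)) ≡ s
signBit-flipSign-pos true  m = refl
signBit-flipSign-pos false m = refl

signBit-flipSign-neg : ∀ s m → signBit (flipSign s (ℤ.negsuc m)) ≡ not s
signBit-flipSign-neg true  m = refl
signBit-flipSign-neg false m = refl

ε-self : ∀ {n} (x : Fin n) → ε x x ≡ + 1
ε-self x rewrite dec-true (x ≟ x) refl = refl

ε-other : ∀ {n} {x i : Fin n} → x ≢ i → ε x i ≡ + 0
ε-other {x = x} {i} x≢i rewrite dec-false (x ≟ i) x≢i = refl

firstSign : ∀ {n} → W n → Fin n → Fin n → Bool
firstSign w x y = if position w x <ᵇ position w y then sgn w x else sgn w y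

firstSign-sym : ∀ {n} (w : W n) {x y} → x ≢ y → firstSign w x y ≡ firstSign w y x
firstSign-sym w {x} {y} x≢y rewrite <ᵇ-flip {position w x} {position w y} (x≢y ∘ position-injective w)
  with position w x <ᵇ position w y
... | true  = refl
... | false = refl

module _ {n : ℕ} (w : W n) {x y : Fin n} (x≢y : x ≢ y) where

  private
    ⊝-support : ∀ i → i ≢ x → i ≢ y → (ε x ⊝ ε y) i ≡ + 0
    ⊝-support i i≢x i≢y = cong₂ (λ u v → u ℤ.+ - v) (ε-other (i≢x ∘ sym)) (ε-other (i≢y ∘ sym))

    ⊕-support : ∀ i → i ≢ x → i ≢ y → (ε x ⊕ ε y) i ≡ + 0
    ⊕-support i i≢x i≢y = cong₂ ℤ._+_ (ε-other (i≢x ∘ sym)) (ε-other (i≢y ∘ sym))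

  isNegative-minus : isNegative (act w (ε x ⊝ ε y)) ≡ (key w y <ᵇ key w x)
  isNegative-minus with ℕₚ.<-cmp (position w x) (position w y)
  ... | tri< x<y _ _ = begin
    isNegative (act w (ε x ⊝ ε y))
      ≡⟨ isNegative-act₂ w (ε x ⊝ ε y) x y ⊝-support (subst (_≢ + 0) (sym at-x) λ ()) x<y ⟩
    signBit (flipSign (sgn w x) ((ε x ⊝ ε y) x))
      ≡⟨ cong (signBit ∘ flipSign (sgn w x)) at-x ⟩
    signBit (flipSign (sgn w x) (+ 1))
      ≡⟨ signBit-flipSign-pos (sgn w x) 0 ⟩
    sgn w x
      ≡⟨ key-order w x<y ⟨
    (key w y <ᵇ key w x) ∎
    where
    open ≡-Reasoning
    at-x : (ε x ⊝ ε y) x ≡ + 1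
    at-x = cong₂ (λ u v → u ℤ.+ - v) (ε-self x) (ε-other (x≢y ∘ sym))
  ... | tri≈ _ x≡y _ = contradiction (position-injective w x≡y) x≢y
  ... | tri> _ _ y<x = begin
    isNegative (act w (ε x ⊝ ε y))
      ≡⟨ isNegative-act₂ w (ε x ⊝ ε y) y x (λ i i≢y i≢x → ⊝-support i i≢x i≢y)
                         (subst (_≢ + 0) (sym at-y) λ ()) y<x ⟩
    signBit (flipSign (sgn w y) ((ε x ⊝ ε y) y))
      ≡⟨ cong (signBit ∘ flipSign (sgn w y)) at-y ⟩
    signBit (flipSign (sgn w y) (ℤ.negsuc 0))
      ≡⟨ signBit-flipSign-neg (sgn w y) 0 ⟩
    not (sgn w y)
      ≡⟨ cong not (key-order w y<x) ⟨
    not (key w x <ᵇ key w y)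
      ≡⟨ <ᵇ-flip (x≢y ∘ key-injective w) ⟨
    (key w y <ᵇ key w x) ∎
    where
    open ≡-Reasoning
    at-y : (ε x ⊝ ε y) y ≡ ℤ.negsuc 0
    at-y = cong₂ (λ u v → u ℤ.+ - v) (ε-other x≢y) (ε-self y)

  isNegative-plus : isNegative (act w (ε x ⊕ ε y)) ≡ firstSign w x y
  isNegative-plus with ℕₚ.<-cmp (position w x) (position w y)
  ... | tri< x<y _ _ = begin
    isNegative (act w (ε x ⊕ ε y))
      ≡⟨ isNegative-act₂ w (ε x ⊕ ε y) x y ⊕-support (subst (_≢ + 0) (sym at-x) λ ()) x<y ⟩
    signBit (flipSign (sgn w x) ((ε x ⊕ ε y) x))
      ≡⟨ cong (signBit ∘ flipSign (sgn w x)) at-x ⟩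
    signBit (flipSign (sgn w x) (+ 1))
      ≡⟨ signBit-flipSign-pos (sgn w x) 0 ⟩
    sgn w x
      ≡⟨ cong (λ b → if b then sgn w x else sgn w y) (<ᵇ-true x<y) ⟨
    firstSign w x y ∎
    where
    open ≡-Reasoning
    at-x : (ε x ⊕ ε y) x ≡ + 1
    at-x = cong₂ ℤ._+_ (ε-self x) (ε-other (x≢y ∘ sym))
  ... | tri≈ _ x≡y _ = contradiction (position-injective w x≡y) x≢y
  ... | tri> _ _ y<x = begin
    isNegative (act w (ε x ⊕ ε y))
      ≡⟨ isNegative-act₂ w (ε x ⊕ ε y) y x (λ i i≢y i≢x → ⊕-support i i≢x i≢y)
                         (subst (_≢ + 0) (sym at-y) λ ()) y<x ⟩
    signBit (flipSign (sgn w y) ((ε x ⊕ ε y) y))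
      ≡⟨ cong (signBit ∘ flipSign (sgn w y)) at-y ⟩
    signBit (flipSign (sgn w y) (+ 1))
      ≡⟨ signBit-flipSign-pos (sgn w y) 0 ⟩
    sgn w y
      ≡⟨ cong (λ b → if b then sgn w x else sgn w y) (<ᵇ-false (ℕₚ.<⇒≯ y<x)) ⟨
    firstSign w x y ∎
    where
    open ≡-Reasoning
    at-y : (ε x ⊕ ε y) y ≡ + 1
    at-y = cong₂ ℤ._+_ (ε-other x≢y) (ε-self y)

isNegative-long : ∀ {n} (w : W n) (k : Fin n) → isNegative (act w (ε k ⊕ ε k)) ≡ sgn w k
isNegative-long w k = begin
  isNegative (act w (ε k ⊕ ε k))
    ≡⟨ isNegative-act w (ε k ⊕ ε k) k earlier (subst (_≢ + 0) (sym at-k) λ ()) ⟩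
  signBit (flipSign (sgn w k) ((ε k ⊕ ε k) k))
    ≡⟨ cong (signBit ∘ flipSign (sgn w k)) at-k ⟩
  signBit (flipSign (sgn w k) (+ 2))
    ≡⟨ signBit-flipSign-pos (sgn w k) 1 ⟩
  sgn w k ∎
  where
  open ≡-Reasoning
  at-k : (ε k ⊕ ε k) k ≡ + 2
  at-k = cong₂ ℤ._+_ (ε-self k) (ε-self k)
  earlier : ∀ i → position w i ℕ.< position w k → (ε k ⊕ ε k) i ≡ + 0
  earlier i i<k = cong₂ ℤ._+_ (ε-other k≢i) (ε-other k≢i)
    where k≢i : k ≢ i
          k≢i refl = ℕₚ.<-irrefl refl i<k

open FoldMap ℕₚ.+-0-monoid using (foldMap; foldMap-posRoots)

length-filter : ∀ {A : Set} (p : A → Bool) xs → length (filter (T? ∘ p) xs) ≡ foldMap (⟦_⟧ ∘ p) xs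
length-filter p []       = refl
length-filter p (x ∷ xs) with p x
... | true  = cong suc (length-filter p xs)
... | false = length-filter p xs

-- The number of roots ε_i + ε_j and 2ε_k that w sends to negative roots.
signPart : ∀ {n} → W n → ℕ
signPart {n} w = pairSum (λ i j → ⟦ firstSign w i j ⟧) + ∑[ k < n ] ⟦ sgn w k ⟧

len≡inversions+signPart : ∀ {n} (w : W n) → len w ≡ inversions (key w) + signPart w
len≡inversions+signPart {n} w = begin
  len w
    ≡⟨ length-filter negative (posRoots n) ⟩
  foldMap (⟦_⟧ ∘ negative) (posRoots n)
    ≡⟨ foldMap-posRoots n (⟦_⟧ ∘ negative) ⟩
  ∑[ i < n ] ∑[ j < n ] foldMap (⟦_⟧ ∘ negative) (rootPairs i j (i <? j)) + ∑[ k < n ] ⟦ negative (long k) ⟧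
    ≡⟨ cong₂ _+_ (sum-cong-≗ λ i → sum-cong-≗ λ j → pair-count i j (i <? j))
                 (sum-cong-≗ λ k → cong ⟦_⟧ (isNegative-long w k)) ⟩
  pairSum (λ i j → ⟦ key w j <ᵇ key w i ⟧ + ⟦ firstSign w i j ⟧) + ∑[ k < n ] ⟦ sgn w k ⟧
    ≡⟨ cong (_+ ∑[ k < n ] ⟦ sgn w k ⟧) (pairSum-+ (λ i j → ⟦ key w j <ᵇ key w i ⟧) _) ⟩
  inversions (key w) + pairSum (λ i j → ⟦ firstSign w i j ⟧) + ∑[ k < n ] ⟦ sgn w k ⟧
    ≡⟨ ℕₚ.+-assoc (inversions (key w)) _ _ ⟩
  inversions (key w) + signPart w ∎
  where
  open ≡-Reasoning
  negative : PosRoot n → Bool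
  negative α = isNegative (act w (rootVec α))
  pair-count : ∀ i j (d : Dec (i < j)) → foldMap (⟦_⟧ ∘ negative) (rootPairs i j d)
               ≡ ⟦ does d ⟧ * (⟦ key w j <ᵇ key w i ⟧ + ⟦ firstSign w i j ⟧)
  pair-count i j (no _)    = refl
  pair-count i j (yes i<j) rewrite isNegative-minus w (Finₚ.<⇒≢ i<j) | isNegative-plus w (Finₚ.<⇒≢ i<j)
    = sym (ℕₚ.+-assoc ⟦ key w j <ᵇ key w i ⟧ ⟦ firstSign w i j ⟧ 0)

-- By definition of _·_, the position, sign and key of w · s[ a , b ]⟨ a<b ⟩ at t are those of w at τ t.
module _ {n : ℕ} (w : W n) {a b : Fin n} (a<b : a < b) where

  open Transposition a<b

  signPart-transpose : signPart (w · s[ a , b ]⟨ a<b ⟩) ≡ signPart w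
  signPart-transpose = cong₂ _+_
    (pairSum-transpose-symmetric (λ i j → ⟦ firstSign w i j ⟧) (λ i j i≢j → cong ⟦_⟧ (firstSign-sym w i≢j)))
    (sym (∑-permute (λ k → ⟦ sgn w k ⟧) (transpose a b)))

  len-transpose :
    len (w · s[ a , b ]⟨ a<b ⟩) + ⟦ key w b <ᵇ key w a ⟧ + 2 * countInside (key w) a b (key w b) (key w a)
    ≡ len w + ⟦ key w a <ᵇ key w b ⟧ + 2 * countInside (key w) a b (key w a) (key w b)
  len-transpose = begin
    len w′ + ⟦ key w b <ᵇ key w a ⟧ + 2 * C′
      ≡⟨ cong (λ l → l + ⟦ key w b <ᵇ key w a ⟧ + 2 * C′)
              (trans (len≡inversions+signPart w′) (cong (λ p → inversions (key w ∘ τ) + p) signPart-transpose)) ⟩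
    inversions (key w ∘ τ) + signPart w + ⟦ key w b <ᵇ key w a ⟧ + 2 * C′
      ≡⟨ move-signPart (inversions (key w ∘ τ)) (signPart w) _ _ ⟩
    inversions (key w ∘ τ) + ⟦ key w b <ᵇ key w a ⟧ + 2 * C′ + signPart w
      ≡⟨ cong (_+ signPart w) (inversions-transpose (key w) (key-injective w)) ⟩
    inversions (key w) + ⟦ key w a <ᵇ key w b ⟧ + 2 * C + signPart w
      ≡⟨ move-signPart (inversions (key w)) (signPart w) _ _ ⟨
    inversions (key w) + signPart w + ⟦ key w a <ᵇ key w b ⟧ + 2 * C
      ≡⟨ cong (λ l → l + ⟦ key w a <ᵇ key w b ⟧ + 2 * C) (len≡inversions+signPart w) ⟨
    len w + ⟦ key w a <ᵇ key w b ⟧ + 2 * C ∎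
    where
    open ≡-Reasoning
    w′ : W n
    w′ = w · s[ a , b ]⟨ a<b ⟩
    C C′ : ℕ
    C  = countInside (key w) a b (key w a) (key w b)
    C′ = countInside (key w) a b (key w b) (key w a)
    move-signPart : ∀ i p x c → i + p + x + c ≡ i + x + c + p
    move-signPart = solve-∀

-- The pairing of 2ρ with the coroot of ε_a − ε_b

open FoldMap ℤₚ.+-0-monoid using () renaming (foldMap to foldMapℤ; foldMap-posRoots to foldMapℤ-posRoots)
open import Algebra.Properties.Monoid.Sum ℤₚ.+-0-monoid using () renaming (sum to ∑ℤ; sum-cong-≗ to ∑ℤ-cong)

∑ℤ-pos : ∀ {m} (f : Fin m → ℕ) → ∑ℤ (λ i → + f i) ≡ + ∑[ i < m ] f i
∑ℤ-pos {zero}  f = refl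
∑ℤ-pos {suc m} f = cong (λ z → + f zero ℤ.+ z) (∑ℤ-pos (f ∘ suc))

twoRho-foldMap : ∀ {n} (L : List (PosRoot n)) (x : Fin n) →
                 foldr (λ α v → rootVec α ⊕ v) zeroV L x ≡ foldMapℤ (λ α → rootVec α x) L
twoRho-foldMap []      x = refl
twoRho-foldMap (α ∷ L) x = cong (λ z → rootVec α x ℤ.+ z) (twoRho-foldMap L x)

twoRho-coordinate : ∀ {n} (x : Fin n) → twoRho n x ≡ + (2 * suc (∑[ j < n ] ⟦ toℕ x <ᵇ toℕ j ⟧))
twoRho-coordinate {n} x = begin
  twoRho n x
    ≡⟨ twoRho-foldMap (posRoots n) x ⟩
  foldMapℤ coord (posRoots n)
    ≡⟨ foldMapℤ-posRoots n coord ⟩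
  ∑ℤ (λ i → ∑ℤ (λ j → foldMapℤ coord (rootPairs i j (i <? j)))) ℤ.+ ∑ℤ (λ k → coord (long k))
    ≡⟨ cong₂ ℤ._+_
         (trans (∑ℤ-cong {n} λ i → trans (∑ℤ-cong {n} λ j → pair-coordinate i j (i <? j))
                                         (∑ℤ-pos {n} (λ j → ⟦ toℕ i <ᵇ toℕ j ⟧ * 2 * δ x i)))
                (∑ℤ-pos {n} (λ i → ∑[ j < n ] (⟦ toℕ i <ᵇ toℕ j ⟧ * 2 * δ x i))))
         (trans (∑ℤ-cong {n} long-coordinate) (∑ℤ-pos {n} (λ k → δ x k * 2))) ⟩
  + (∑[ i < n ] ∑[ j < n ] (⟦ toℕ i <ᵇ toℕ j ⟧ * 2 * δ x i) + ∑[ k < n ] (δ x k * 2))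
    ≡⟨ cong +_ (cong₂ _+_ (∑∑-δ x (λ i j → ⟦ toℕ i <ᵇ toℕ j ⟧ * 2)) (∑-δ x (λ _ → 2))) ⟩
  + (∑[ j < n ] (⟦ toℕ x <ᵇ toℕ j ⟧ * 2) + 2)
    ≡⟨ cong (λ s → + (s + 2)) (*-distribʳ-sum {n} 2 (λ j → ⟦ toℕ x <ᵇ toℕ j ⟧)) ⟨
  + (∑[ j < n ] ⟦ toℕ x <ᵇ toℕ j ⟧ * 2 + 2)
    ≡⟨ cong +_ (s*2+2≡2*[1+s] (∑[ j < n ] ⟦ toℕ x <ᵇ toℕ j ⟧)) ⟩
  + (2 * suc (∑[ j < n ] ⟦ toℕ x <ᵇ toℕ j ⟧)) ∎
  where
  open ≡-Reasoning
  coord : PosRoot n → ℤ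
  coord α = rootVec α x
  pair-coordinate : ∀ i j (d : Dec (i < j)) → foldMapℤ coord (rootPairs i j d) ≡ + (⟦ does d ⟧ * 2 * δ x i)
  pair-coordinate i j (no _) = refl
  pair-coordinate i j (yes _) with does (i ≟ x) | does (j ≟ x)
  ... | true  | true  = refl
  ... | true  | false = refl
  ... | false | true  = refl
  ... | false | false = refl
  long-coordinate : ∀ k → coord (long k) ≡ + (δ x k * 2)
  long-coordinate k with does (k ≟ x)
  ... | true  = refl
  ... | false = refl
  s*2+2≡2*[1+s] : ∀ s → s * 2 + 2 ≡ 2 * suc s
  s*2+2≡2*[1+s] = solve-∀

dot-zeroʳ : ∀ {n} (v : Vecℤ n) → dot v (λ _ → + 0) ≡ + 0
dot-zeroʳ {zero}  v = refl
dot-zeroʳ {suc n} v = cong₂ ℤ._+_ (ℤₚ.*-zeroʳ (v zero)) (dot-zeroʳ (v ∘ suc))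

dot-ε : ∀ {n} (v : Vecℤ n) (a : Fin n) → dot v (ε a) ≡ v a
dot-ε {suc n} v zero    =
  trans (cong₂ ℤ._+_ (ℤₚ.*-identityʳ (v zero)) (dot-zeroʳ (v ∘ suc))) (ℤₚ.+-identityʳ (v zero))
dot-ε {suc n} v (suc a) =
  trans (cong₂ ℤ._+_ (ℤₚ.*-zeroʳ (v zero)) (dot-ε (v ∘ suc) a)) (ℤₚ.+-identityˡ (v (suc a)))

dot-⊝ : ∀ {n} (v u u′ : Vecℤ n) → dot v (u ⊝ u′) ≡ dot v u ℤ.- dot v u′
dot-⊝ {zero}  v u u′ = refl
dot-⊝ {suc n} v u u′ =
  trans (cong (λ z → v zero ℤ.* (u zero ℤ.- u′ zero) ℤ.+ z) (dot-⊝ (v ∘ suc) (u ∘ suc) (u′ ∘ suc)))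
        (distrib (v zero) (u zero) (u′ zero) _ _)
  where distrib : ∀ a b c d e → a ℤ.* (b ℤ.- c) ℤ.+ (d ℤ.- e) ≡ (a ℤ.* b ℤ.+ d) ℤ.- (a ℤ.* c ℤ.+ e)
        distrib = ℤ-solve-∀

countAbove-split : ∀ {n} {a b : Fin n} → a < b →
  ∑[ j < n ] ⟦ toℕ a <ᵇ toℕ j ⟧ ≡ ∑[ j < n ] ⟦ toℕ b <ᵇ toℕ j ⟧ + 1 + gap a b
countAbove-split {n} {a} {b} a<b = begin
  ∑[ j < n ] ⟦ toℕ a <ᵇ toℕ j ⟧
    ≡⟨ sum-cong-≗ pointwise ⟩
  ∑[ j < n ] (⟦ toℕ b <ᵇ toℕ j ⟧ + δ b j * 1 + ⟦ toℕ a < toℕ j < toℕ b ⟧ * 1)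
    ≡⟨ ∑-distrib-+ (λ j → ⟦ toℕ b <ᵇ toℕ j ⟧ + δ b j * 1) (λ j → ⟦ toℕ a < toℕ j < toℕ b ⟧ * 1) ⟩
  ∑[ j < n ] (⟦ toℕ b <ᵇ toℕ j ⟧ + δ b j * 1) + sumBetween a b (λ _ → 1)
    ≡⟨ cong (_+ sumBetween a b (λ _ → 1)) (trans (∑-distrib-+ (λ j → ⟦ toℕ b <ᵇ toℕ j ⟧) (λ j → δ b j * 1))
                                                 (cong (λ z → ∑[ j < n ] ⟦ toℕ b <ᵇ toℕ j ⟧ + z) (∑-δ b (λ _ → 1)))) ⟩
  ∑[ j < n ] ⟦ toℕ b <ᵇ toℕ j ⟧ + 1 + sumBetween a b (λ _ → 1) ∎
  where
  open ≡-Reasoning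
  pointwise : ∀ j → ⟦ toℕ a <ᵇ toℕ j ⟧ ≡ ⟦ toℕ b <ᵇ toℕ j ⟧ + δ b j * 1 + ⟦ toℕ a < toℕ j < toℕ b ⟧ * 1
  pointwise j with Finₚ.<-cmp j b
  ... | tri< j<b _ _ rewrite <ᵇ-false (ℕₚ.<⇒≯ j<b) | dec-false (j ≟ b) (Finₚ.<⇒≢ j<b) | <ᵇ-true j<b
    with toℕ a <ᵇ toℕ j
  ...   | true  = refl
  ...   | false = refl
  pointwise j | tri≈ _ refl _ rewrite <ᵇ-true a<b | <ᵇ-irrefl (toℕ b) | dec-true (b ≟ b) refl = refl
  pointwise j | tri> _ _ b<j
    rewrite <ᵇ-true (ℕₚ.<-trans a<b b<j) | <ᵇ-true b<j | dec-false (j ≟ b) (Finₚ.<⇒≢ b<j ∘ sym)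
          | <ᵇ-false (ℕₚ.<⇒≯ b<j) = refl

twoRhoPair-minus : ∀ {n} (a b : Fin n) (a<b : a < b) →
                   twoRhoPair [ a , b ]⟨ a<b ⟩ ≡ + (2 * suc (gap a b))
twoRhoPair-minus {n} a b a<b = begin
  dot (twoRho n) (ε a ⊝ ε b)
    ≡⟨ dot-⊝ (twoRho n) (ε a) (ε b) ⟩
  dot (twoRho n) (ε a) ℤ.- dot (twoRho n) (ε b)
    ≡⟨ cong₂ ℤ._-_ (trans (dot-ε (twoRho n) a) (twoRho-coordinate a))
                   (trans (dot-ε (twoRho n) b) (twoRho-coordinate b)) ⟩
  + (2 * suc A) ℤ.- + (2 * suc B)
    ≡⟨ cong (λ z → + (2 * suc z) ℤ.- + (2 * suc B)) (countAbove-split a<b) ⟩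
  + (2 * suc (B + 1 + N)) ℤ.- + (2 * suc B)
    ≡⟨ cong (λ z → + z ℤ.- + (2 * suc B)) (regroup B N) ⟩
  + (2 * suc B) ℤ.+ + (2 * suc N) ℤ.- + (2 * suc B)
    ≡⟨ cancel (+ (2 * suc B)) (+ (2 * suc N)) ⟩
  + (2 * suc N) ∎
  where
  open ≡-Reasoning
  A B N : ℕ
  A = ∑[ j < n ] ⟦ toℕ a <ᵇ toℕ j ⟧
  B = ∑[ j < n ] ⟦ toℕ b <ᵇ toℕ j ⟧
  N = gap a b
  regroup : ∀ B N → 2 * suc (B + 1 + N) ≡ 2 * suc B + 2 * suc N
  regroup = solve-∀
  cancel : ∀ X K → X ℤ.+ K ℤ.- X ≡ K
  cancel = ℤ-solve-∀

-- Edges of the quantum Bruhat graph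

BruhatStep QuantumStep Step : ∀ {n} → (Fin n → ℕ) → Fin n → Fin n → Set
BruhatStep  u a b = u a ℕ.< u b × (∀ t → a < t → t < b → ¬ (u a ℕ.< u t × u t ℕ.< u b))
QuantumStep u a b = u b ℕ.< u a × (∀ t → a < t → t < b → u b ℕ.< u t × u t ℕ.< u a)
Step        u a b = BruhatStep u a b ⊎ QuantumStep u a b

quantum-condition⇔ : ∀ L′ L K → (+ L′ ≡ + L ℤ.+ - + K ℤ.+ + 1) ⇔ (L′ + K ≡ L + 1)
quantum-condition⇔ L′ L K = mk⇔
  (λ eq → ℤₚ.+-injective (trans (cong (ℤ._+ + K) eq) (cancel (+ L) (+ K))))
  (λ eq → trans (sym (cancel′ (+ L′) (+ K))) (trans (cong (λ z → + z ℤ.- + K) eq) (reorder (+ L) (+ K))))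
  where
  cancel : ∀ X Y → X ℤ.+ - Y ℤ.+ + 1 ℤ.+ Y ≡ X ℤ.+ + 1
  cancel = ℤ-solve-∀
  cancel′ : ∀ X Y → X ℤ.+ Y ℤ.- Y ≡ X
  cancel′ = ℤ-solve-∀
  reorder : ∀ X Y → X ℤ.+ + 1 ℤ.- Y ≡ X ℤ.+ - Y ℤ.+ + 1
  reorder = ℤ-solve-∀

module _ {n : ℕ} (w : W n) {a b : Fin n} (a<b : a < b) where

  private
    u : Fin n → ℕ
    u = key w
    w′ : W n
    w′ = w · s[ a , b ]⟨ a<b ⟩
    x+0+0≡x : ∀ x → x + 0 + 0 ≡ x
    x+0+0≡x = solve-∀
    x+1+y≡1+x+y : ∀ x y → x + 1 + y ≡ suc (x + y)
    x+1+y≡1+x+y = solve-∀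
    a≢b : a ≢ b
    a≢b = Finₚ.<⇒≢ a<b
    descent-shape : ∀ L c → suc (L + 2 * c) + 1 ≡ L + 2 * suc c
    descent-shape = solve-∀

  len-ascent : u a ℕ.< u b → len w′ ≡ suc (len w + 2 * countInside u a b (u a) (u b))
  len-ascent ua<ub = begin
    len w′
      ≡⟨ x+0+0≡x (len w′) ⟨
    len w′ + ⟦ false ⟧ + 2 * 0
      ≡⟨ cong₂ (λ p c → len w′ + ⟦ p ⟧ + 2 * c) (<ᵇ-false (ℕₚ.<⇒≯ ua<ub)) (countInside-reversed u a b ua<ub) ⟨
    len w′ + ⟦ u b <ᵇ u a ⟧ + 2 * countInside u a b (u b) (u a)
      ≡⟨ len-transpose w a<b ⟩
    len w + ⟦ u a <ᵇ u b ⟧ + 2 * countInside u a b (u a) (u b)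
      ≡⟨ cong (λ p → len w + ⟦ p ⟧ + 2 * countInside u a b (u a) (u b)) (<ᵇ-true ua<ub) ⟩
    len w + 1 + 2 * countInside u a b (u a) (u b)
      ≡⟨ x+1+y≡1+x+y (len w) _ ⟩
    suc (len w + 2 * countInside u a b (u a) (u b)) ∎
    where open ≡-Reasoning

  len-descent : u b ℕ.< u a → len w ≡ suc (len w′ + 2 * countInside u a b (u b) (u a))
  len-descent ub<ua = begin
    len w
      ≡⟨ x+0+0≡x (len w) ⟨
    len w + ⟦ false ⟧ + 2 * 0
      ≡⟨ cong₂ (λ p c → len w + ⟦ p ⟧ + 2 * c) (<ᵇ-false (ℕₚ.<⇒≯ ub<ua)) (countInside-reversed u a b ub<ua) ⟨
    len w + ⟦ u a <ᵇ u b ⟧ + 2 * countInside u a b (u a) (u b)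
      ≡⟨ len-transpose w a<b ⟨
    len w′ + ⟦ u b <ᵇ u a ⟧ + 2 * countInside u a b (u b) (u a)
      ≡⟨ cong (λ p → len w′ + ⟦ p ⟧ + 2 * countInside u a b (u b) (u a)) (<ᵇ-true ub<ua) ⟩
    len w′ + 1 + 2 * countInside u a b (u b) (u a)
      ≡⟨ x+1+y≡1+x+y (len w′) _ ⟩
    suc (len w′ + 2 * countInside u a b (u b) (u a)) ∎
    where open ≡-Reasoning

  bruhatEdge⇔ : (len w′ ≡ suc (len w)) ⇔ BruhatStep u a b
  bruhatEdge⇔ = mk⇔ to from
    where
    to : len w′ ≡ suc (len w) → BruhatStep u a b
    to up with ℕₚ.<-cmp (u a) (u b)
    ... | tri< ua<ub _ _ = ua<ub , Equivalence.to (countInside≡0⇔ u a b) (ℕₚ.m+n≡0⇒m≡0 C 2C≡0)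
      where
      C : ℕ
      C = countInside u a b (u a) (u b)
      2C≡0 : 2 * C ≡ 0
      2C≡0 = ℕₚ.+-cancelˡ-≡ (len w) _ _
        (ℕₚ.suc-injective (trans (sym (len-ascent ua<ub)) (trans up (cong suc (sym (ℕₚ.+-identityʳ (len w)))))))
    ... | tri≈ _ ua≡ub _ = contradiction (key-injective w ua≡ub) a≢b
    ... | tri> _ _ ub<ua = contradiction (subst (len w ℕ.<_) (sym up) (ℕₚ.n<1+n (len w))) (ℕₚ.<-asym w′<w)
      where
      w′<w : len w′ ℕ.< len w
      w′<w = subst (len w′ ℕ.<_) (sym (len-descent ub<ua)) (s≤s (ℕₚ.m≤m+n (len w′) _))
    from : BruhatStep u a b → len w′ ≡ suc (len w)
    from (ua<ub , none) = trans (len-ascent ua<ub)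
      (trans (cong (λ c → suc (len w + 2 * c)) (Equivalence.from (countInside≡0⇔ u a b) none))
             (cong suc (ℕₚ.+-identityʳ (len w))))

  quantumEdge⇔ : (len w′ + 2 * suc (gap a b) ≡ len w + 1) ⇔ QuantumStep u a b
  quantumEdge⇔ = mk⇔ to from
    where
    to : len w′ + 2 * suc (gap a b) ≡ len w + 1 → QuantumStep u a b
    to eq with ℕₚ.<-cmp (u a) (u b)
    ... | tri< ua<ub _ _ = contradiction
          (trans (sym (overshoot (len w) (countInside u a b (u a) (u b)) (gap a b)))
                 (trans (cong (_+ 2 * suc (gap a b)) (sym (len-ascent ua<ub))) eq))
          (ℕₚ.m+1+n≢m (len w + 1))
      where
      overshoot : ∀ L c g → suc (L + 2 * c) + 2 * suc g ≡ L + 1 + suc (2 * c + 2 * g + 1)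
      overshoot = solve-∀
    ... | tri≈ _ ua≡ub _ = contradiction (key-injective w ua≡ub) a≢b
    ... | tri> _ _ ub<ua = ub<ua , Equivalence.to (countInside≡gap⇔ u a b) (sym C′≡gap)
      where
      C′ : ℕ
      C′ = countInside u a b (u b) (u a)
      C′≡gap : gap a b ≡ C′
      C′≡gap = ℕₚ.suc-injective (ℕₚ.*-cancelˡ-≡ _ _ 2 (ℕₚ.+-cancelˡ-≡ (len w′) _ _
        (trans eq (trans (cong (_+ 1) (len-descent ub<ua)) (descent-shape (len w′) C′)))))
    from : QuantumStep u a b → len w′ + 2 * suc (gap a b) ≡ len w + 1
    from (ub<ua , all) = begin
      len w′ + 2 * suc (gap a b)
        ≡⟨ cong (λ c → len w′ + 2 * suc c) (Equivalence.from (countInside≡gap⇔ u a b) all) ⟨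
      len w′ + 2 * suc (countInside u a b (u b) (u a))
        ≡⟨ descent-shape (len w′) _ ⟨
      suc (len w′ + 2 * countInside u a b (u b) (u a)) + 1
        ≡⟨ cong (_+ 1) (len-descent ub<ua) ⟨
      len w + 1 ∎
      where open ≡-Reasoning

  qbgEdge⇔Step : QBGEdge w [ a , b ]⟨ a<b ⟩ ⇔ Step u a b
  qbgEdge⇔Step = bruhatEdge⇔ ⊎-⇔ quantum⇔
    where
    quantum⇔ : (+ len w′ ≡ + len w ℤ.+ - twoRhoPair [ a , b ]⟨ a<b ⟩ ℤ.+ + 1) ⇔ QuantumStep u a b
    quantum⇔ rewrite twoRhoPair-minus a b a<b = Compose.equivalence (quantum-condition⇔ (len w′) (len w) _) quantumEdge⇔

module ThreePositions {n : ℕ} (u : Fin n → ℕ) (u-injective : ∀ {i j} → u i ≡ u j → i ≡ j)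
                      {k l m : Fin n} (k<l : k < l) (l<m : l < m) where

  private
    k<m : k < m
    k<m = <-trans k<l l<m
    module τₗₘ = Transposition l<m
    module τₖₘ = Transposition k<m

    u-≢⇒<⊎> : ∀ {i j} → i ≢ j → u i ℕ.< u j ⊎ u j ℕ.< u i
    u-≢⇒<⊎> {i} {j} i≢j with ℕₚ.<-cmp (u i) (u j)
    ... | tri< lt _ _ = inj₁ lt
    ... | tri≈ _ eq _ = contradiction (u-injective eq) i≢j
    ... | tri> _ _ gt = inj₂ gt

  Step-restrict : Step u k m → Step (u ∘ τₗₘ.τ) k l
  Step-restrict step rewrite τₗₘ.τ-a | τₗₘ.τ-fix (Finₚ.<⇒≢ k<l) (Finₚ.<⇒≢ k<m) with step
  ... | inj₁ (uk<um , none) = inj₁ (uk<um , none′)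
    where
    none′ : ∀ t → k < t → t < l → ¬ (u k ℕ.< u (τₗₘ.τ t) × u (τₗₘ.τ t) ℕ.< u m)
    none′ t k<t t<l rewrite τₗₘ.τ-fix (Finₚ.<⇒≢ t<l) (Finₚ.<⇒≢ (<-trans t<l l<m)) =
      none t k<t (<-trans t<l l<m)
  ... | inj₂ (um<uk , all) = inj₂ (um<uk , all′)
    where
    all′ : ∀ t → k < t → t < l → u m ℕ.< u (τₗₘ.τ t) × u (τₗₘ.τ t) ℕ.< u k
    all′ t k<t t<l rewrite τₗₘ.τ-fix (Finₚ.<⇒≢ t<l) (Finₚ.<⇒≢ (<-trans t<l l<m)) =
      all t k<t (<-trans t<l l<m)

  private
    τₖₘ-l : τₖₘ.τ l ≡ l
    τₖₘ-l = τₖₘ.τ-fix (Finₚ.<⇒≢ k<l ∘ sym) (Finₚ.<⇒≢ l<m)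

    τₖₘ-inner : ∀ {t} → l < t → t < m → u (τₖₘ.τ t) ≡ u t
    τₖₘ-inner l<t t<m = cong u (τₖₘ.τ-fix (Finₚ.<⇒≢ (<-trans k<l l<t) ∘ sym) (Finₚ.<⇒≢ t<m))

  Step-exchange : Step u k m → Step u l m → Step (u ∘ τₖₘ.τ) l m
  Step-exchange stepₖₘ stepₗₘ rewrite τₖₘ-l | τₖₘ.τ-b with stepₖₘ | stepₗₘ
  ... | inj₁ (uk<um , noneₖₘ) | inj₁ (ul<um , noneₗₘ) = inj₁ (ul<uk , none)
    where
    ul<uk : u l ℕ.< u k
    ul<uk with u-≢⇒<⊎> (Finₚ.<⇒≢ k<l ∘ sym)
    ... | inj₁ ul<uk = ul<uk
    ... | inj₂ uk<ul = contradiction (uk<ul , ul<um) (noneₖₘ l k<l l<m)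
    none : ∀ t → l < t → t < m → ¬ (u l ℕ.< u (τₖₘ.τ t) × u (τₖₘ.τ t) ℕ.< u k)
    none t l<t t<m rewrite τₖₘ-inner l<t t<m =
      λ (ul<ut , ut<uk) → noneₗₘ t l<t t<m (ul<ut , ℕₚ.<-trans ut<uk uk<um)
  ... | inj₁ (uk<um , _) | inj₂ (um<ul , allₗₘ) = inj₂ (ℕₚ.<-trans uk<um um<ul , all)
    where
    all : ∀ t → l < t → t < m → u k ℕ.< u (τₖₘ.τ t) × u (τₖₘ.τ t) ℕ.< u l
    all t l<t t<m rewrite τₖₘ-inner l<t t<m =
      ℕₚ.<-trans uk<um (proj₁ (allₗₘ t l<t t<m)) , proj₂ (allₗₘ t l<t t<m)
  ... | inj₂ (_ , allₖₘ) | inj₁ (ul<um , _) = contradiction ul<um (ℕₚ.<-asym (proj₁ (allₖₘ l k<l l<m)))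
  ... | inj₂ (_ , allₖₘ) | inj₂ (_ , allₗₘ) = inj₁ (proj₂ (allₖₘ l k<l l<m) , none)
    where
    none : ∀ t → l < t → t < m → ¬ (u l ℕ.< u (τₖₘ.τ t) × u (τₖₘ.τ t) ℕ.< u k)
    none t l<t t<m rewrite τₖₘ-inner l<t t<m =
      λ (ul<ut , _) → ℕₚ.<-asym ul<ut (proj₂ (allₗₘ t l<t t<m))

  Step-exchange⁻¹ : Step u k m → Step (u ∘ τₖₘ.τ) l m → Step u l m
  Step-exchange⁻¹ stepₖₘ stepᵥ rewrite τₖₘ-l | τₖₘ.τ-b with stepₖₘ | stepᵥ
  ... | inj₁ (uk<um , noneₖₘ) | inj₁ (ul<uk , noneᵥ) = inj₁ (ℕₚ.<-trans ul<uk uk<um , none)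
    where
    none : ∀ t → l < t → t < m → ¬ (u l ℕ.< u t × u t ℕ.< u m)
    none t l<t t<m (ul<ut , ut<um) with u-≢⇒<⊎> (Finₚ.<⇒≢ (<-trans k<l l<t) ∘ sym)
    ... | inj₁ ut<uk =
      noneᵥ t l<t t<m (subst (λ z → u l ℕ.< z × z ℕ.< u k) (sym (τₖₘ-inner l<t t<m)) (ul<ut , ut<uk))
    ... | inj₂ uk<ut = noneₖₘ t (<-trans k<l l<t) t<m (uk<ut , ut<um)
  ... | inj₁ (uk<um , noneₖₘ) | inj₂ (uk<ul , allᵥ) = inj₂ (um<ul , all)
    where
    um<ul : u m ℕ.< u l
    um<ul with u-≢⇒<⊎> (Finₚ.<⇒≢ l<m)
    ... | inj₁ ul<um = contradiction (uk<ul , ul<um) (noneₖₘ l k<l l<m)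
    ... | inj₂ um<ul = um<ul
    all : ∀ t → l < t → t < m → u m ℕ.< u t × u t ℕ.< u l
    all t l<t t<m with allᵥ t l<t t<m
    ... | uk<ut , ut<ul rewrite τₖₘ-inner l<t t<m with u-≢⇒<⊎> (Finₚ.<⇒≢ t<m)
    ...   | inj₁ ut<um = contradiction (uk<ut , ut<um) (noneₖₘ t (<-trans k<l l<t) t<m)
    ...   | inj₂ um<ut = um<ut , ut<ul
  ... | inj₂ (_ , allₖₘ) | inj₁ (_ , noneᵥ) = inj₂ (proj₁ (allₖₘ l k<l l<m) , all)
    where
    all : ∀ t → l < t → t < m → u m ℕ.< u t × u t ℕ.< u l
    all t l<t t<m with allₖₘ t (<-trans k<l l<t) t<m
    ... | um<ut , ut<uk with u-≢⇒<⊎> (Finₚ.<⇒≢ l<t ∘ sym)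
    ...   | inj₁ ut<ul = um<ut , ut<ul
    ...   | inj₂ ul<ut = contradiction
      (subst (λ z → u l ℕ.< z × z ℕ.< u k) (sym (τₖₘ-inner l<t t<m)) (ul<ut , ut<uk)) (noneᵥ t l<t t<m)
  ... | inj₂ (_ , allₖₘ) | inj₂ (uk<ul , _) = contradiction uk<ul (ℕₚ.<-asym (proj₂ (allₖₘ l k<l l<m)))

lemma6p2 : (n : ℕ) (w : W n) (k l m : Fin n) (k<l : k < l) (l<m : l < m) →
  let k<m = <-trans k<l l<m in
  let c1 = QBGEdge w [ k , m ]⟨ k<m ⟩
           × (QBGEdge w [ l , m ]⟨ l<m ⟩ × QBGEdge (w · s[ l , m ]⟨ l<m ⟩) [ k , l ]⟨ k<l ⟩) in
  let c2 = QBGEdge w [ k , m ]⟨ k<m ⟩ × QBGEdge w [ l , m ]⟨ l<m ⟩ in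
  let c3 = QBGEdge w [ k , m ]⟨ k<m ⟩ × QBGEdge (w · s[ k , m ]⟨ k<m ⟩) [ l , m ]⟨ l<m ⟩ in
  (c1 ⇔ c2) × (c2 ⇔ c3)
lemma6p2 n w k l m k<l l<m =
  mk⇔ (λ (e-km , e-lm , _) → e-km , e-lm)
      (λ (e-km , e-lm) → e-km , e-lm , edge (w · s[ l , m ]⟨ l<m ⟩) k<l (Step-restrict (step w k<m e-km))) ,
  mk⇔ (λ (e-km , e-lm) → e-km , edge (w · s[ k , m ]⟨ k<m ⟩) l<m (Step-exchange (step w k<m e-km) (step w l<m e-lm)))
      (λ (e-km , e-lm′) → e-km ,
         edge w l<m (Step-exchange⁻¹ (step w k<m e-km) (step (w · s[ k , m ]⟨ k<m ⟩) l<m e-lm′)))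
  where
  k<m : k < m
  k<m = <-trans k<l l<m
  open ThreePositions (key w) (key-injective w) k<l l<m
  step : (x : W n) {a b : Fin n} (a<b : a < b) → QBGEdge x [ a , b ]⟨ a<b ⟩ → Step (key x) a b
  step x a<b = Equivalence.to (qbgEdge⇔Step x a<b)
  edge : (x : W n) {a b : Fin n} (a<b : a < b) → Step (key x) a b → QBGEdge x [ a , b ]⟨ a<b ⟩
  edge x a<b = Equivalence.from (qbgEdge⇔Step x a<b)
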